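{- Let $p$ be a prime and let $a,b$ be nonzero integers such that the binary cubic form $C(x,y)=ax^3+by^3$ is primitive (i.e. $\gcd(a,b)=1$). If $C$ is anisotropic modulo $p$, then $R(C)$ is not dense in $\mathbb{Q}_p$.
   Context: For a cubic form $C$ in $r$ variables with integer coefficients, the ratio set is $R(C)=\{C(\overline{x})/C(\overline{y}) : \overline{x},\overline{y}\in\mathbb{Z}^r,\ C(\overline{y})\neq 0\}\subseteq\mathbb{Q}$, and density is with respect to the $p$-adic topology on $\mathbb{Q}_p$. The form $C$ is anisotropic modulo $p$ if there is no $(x,y)\in\mathbb{Z}^2$ with $(x,y)\not\equiv(0,0)\pmod p$ and $C(x,y)\equiv 0\pmod p$. -}

module Defs where

open import Data.Nat as ℕ using (ℕ; suc)
open import Data.Nat.Primality using (Prime)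
open import Data.Integer as ℤ using (ℤ; +_; -[1+_]; 0ℤ; 1ℤ)
open import Data.Integer.GCD using (gcd)
open import Data.Integer.Divisibility using (_∣_)
open import Data.Rational as ℚ using (ℚ; _/_)
open import Data.Product using (Σ; ∃; _×_; _,_)
open import Data.Empty using (⊥-elim)
open import Relation.Nullary using (¬_)
open import Relation.Binary.PropositionalEquality using (_≡_; _≢_; refl)

diagCubic : ℤ → ℤ → ℤ → ℤ → ℤ
diagCubic a b x y = a ℤ.* (x ℤ.* x ℤ.* x) ℤ.+ b ℤ.* (y ℤ.* y ℤ.* y)

ratio : ℤ → (d : ℤ) → d ≢ 0ℤ → ℚ
ratio n (+ 0) h = ⊥-elim (h refl)
ratio n (+ (suc k)) _ = n / suc k
ratio n -[1+ k ] _ = (ℤ.- n) / suc k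

InRatioSet : ℤ → ℤ → ℚ → Set
InRatioSet a b r =
  Σ ℤ λ x₁ → Σ ℤ λ x₂ → Σ ℤ λ y₁ → Σ ℤ λ y₂ →
  Σ (diagCubic a b y₁ y₂ ≢ 0ℤ) λ h →
  r ≡ ratio (diagCubic a b x₁ x₂) (diagCubic a b y₁ y₂) h

-- p-adic closeness on ℚ: |r - q|_p ≤ p^(-k), i.e. p^k divides the numerator
-- of the reduced fraction r - q (numerator 0 when r = q).
PAdicClose : ℕ → ℕ → ℚ → ℚ → Set
PAdicClose p k r q = + (p ℕ.^ k) ∣ ℚ.ℚ.numerator (r ℚ.- q)

-- A subset S of ℚ is dense in ℚ_p. Since ℚ is dense in ℚ_p, this holds iff
-- every p-adic ball around a rational point, of radius p^(-k), meets S.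
DenseInQp : ℕ → (ℚ → Set) → Set
DenseInQp p S = (q : ℚ) (k : ℕ) → Σ ℚ λ r → S r × PAdicClose p k r q

AnisotropicMod : ℕ → ℤ → ℤ → Set
AnisotropicMod p a b =
  (x y : ℤ) → ¬ ((+ p ∣ x) × (+ p ∣ y)) → ¬ (+ p ∣ diagCubic a b x y)

{-# OPTIONS --safe #-}
module Submission where

-- If p ∣ C(x, y), anisotropy forces p ∣ x and p ∣ y, so C(x, y) = p³ C(x/p, y/p). Hence every
-- nonzero element of R(C) has p-adic valuation divisible by 3, whereas every rational within
-- p⁻² of p has valuation 1, so the ball of radius p⁻² around p misses R(C). Instead of
-- valuations, the proof runs a descent on the congruence C(x)/C(y) ≡ p (mod p²): it forces
-- p ∣ C(x), then p ∣ C(y), and cancelling p³ leaves the same congruence for smaller values of C.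

open import Defs
open import Data.Nat as ℕ using (ℕ; suc)
import Data.Nat.Properties as ℕP
import Data.Nat.Divisibility as ℕD
import Data.Nat.Coprimality as Coprimality
open import Data.Nat.Induction using (<-wellFounded)
open import Data.Nat.Primality using (Prime; euclidsLemma; prime⇒nonZero; prime⇒nonTrivial)
open import Data.Integer as ℤ using (ℤ; +_; -[1+_]; 0ℤ; 1ℤ; _*_; _+_; _-_; -_; ∣_∣)
import Data.Integer.Properties as ℤP
open import Data.Integer.Divisibility.Signed
  using (_∣_; divides; _∣?_; ∣ᵤ⇒∣; ∣⇒∣ᵤ; ∣-refl; ∣-trans; ∣m⇒∣m*n; ∣n⇒∣m*n; ∣m∣n⇒∣m+n; ∣m∣n⇒∣m-n)
open import Data.Integer.GCD using (gcd)
open import Data.Integer.Tactic.RingSolver using (solve)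
open import Data.Rational as ℚ using (ℚ; mkℚ; ↥_; ↧_; ↧ₙ_)
import Data.Rational.Properties as ℚP
open import Data.List using (_∷_; [])
open import Data.Product using (Σ; _×_; _,_)
open import Data.Sum using (inj₁; inj₂)
open import Induction.WellFounded using (Acc; acc)
open import Relation.Nullary using (¬_; yes; no; contradiction)
open import Relation.Binary.PropositionalEquality
  using (_≡_; _≢_; refl; sym; trans; cong; subst; subst₂; cong₂; module ≡-Reasoning)
open ≡-Reasoning

diagCubic-scale : ∀ a b x y k → diagCubic a b (x * k) (y * k) ≡ diagCubic a b x y * (k * k * k)
diagCubic-scale a b x y k = begin
  a * (x * k * (x * k) * (x * k)) + b * (y * k * (y * k) * (y * k))
    ≡⟨ solve (a ∷ b ∷ x ∷ y ∷ k ∷ []) ⟩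
  (a * (x * x * x) + b * (y * y * y)) * (k * k * k) ∎

↥[i/n]*n≡i*↧[i/n] : ∀ i n .{{_ : ℕ.NonZero n}} → ↥ (i ℚ./ n) * + n ≡ i * ↧ (i ℚ./ n)
↥[i/n]*n≡i*↧[i/n] i n = begin
  ↥ (i ℚ./ n) * + n                         ≡⟨ cong (↥ (i ℚ./ n) *_) (ℚP.↧-/ i n) ⟨
  ↥ (i ℚ./ n) * (↧ (i ℚ./ n) * gcd i (+ n)) ≡⟨ swap (↥ (i ℚ./ n)) (↧ (i ℚ./ n)) (gcd i (+ n)) ⟩
  ↥ (i ℚ./ n) * gcd i (+ n) * ↧ (i ℚ./ n)   ≡⟨ cong (_* ↧ (i ℚ./ n)) (ℚP.↥-/ i n) ⟩
  i * ↧ (i ℚ./ n)                           ∎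
  where
  swap : ∀ x y z → x * (y * z) ≡ x * z * y
  swap x y z = solve (x ∷ y ∷ z ∷ [])

↥-+ : ∀ r s → ↥ (r ℚ.+ s) * (↧ r * ↧ s) ≡ (↥ r * ↧ s + ↥ s * ↧ r) * ↧ (r ℚ.+ s)
↥-+ r@record{} s@record{} =
  subst (λ d → ↥ (r ℚ.+ s) * d ≡ (↥ r * ↧ s + ↥ s * ↧ r) * ↧ (r ℚ.+ s)) (ℤP.pos-* (↧ₙ r) (↧ₙ s))
    (↥[i/n]*n≡i*↧[i/n] (↥ r * ↧ s + ↥ s * ↧ r) (↧ₙ r ℕ.* ↧ₙ s))

↥-minus : ∀ r s → ↥ (r ℚ.- s) * (↧ r * ↧ s) ≡ (↥ r * ↧ s - ↥ s * ↧ r) * ↧ (r ℚ.- s)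
↥-minus r s = begin
  ↥ (r ℚ.- s) * (↧ r * ↧ s)                 ≡⟨ cong (λ d → ↥ (r ℚ.- s) * (↧ r * d)) (ℚP.↧-neg s) ⟨
  ↥ (r ℚ.- s) * (↧ r * ↧ (ℚ.- s))           ≡⟨ ↥-+ r (ℚ.- s) ⟩
  (↥ r * ↧ (ℚ.- s) + ↥ (ℚ.- s) * ↧ r) * ↧ (r ℚ.- s)
    ≡⟨ cong₂ (λ d n → (↥ r * d + n * ↧ r) * ↧ (r ℚ.- s)) (ℚP.↧-neg s) (ℚP.↥-neg s) ⟩
  (↥ r * ↧ s + (- ↥ s) * ↧ r) * ↧ (r ℚ.- s)
    ≡⟨ cong (λ m → (↥ r * ↧ s + m) * ↧ (r ℚ.- s)) (ℤP.neg-distribˡ-* (↥ s) (↧ r)) ⟨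
  (↥ r * ↧ s - ↥ s * ↧ r) * ↧ (r ℚ.- s)     ∎

↥-ratio : ∀ n d (d≢0 : d ≢ 0ℤ) → ↥ (ratio n d d≢0) * d ≡ n * ↧ (ratio n d d≢0)
↥-ratio n (+ 0)      d≢0 = contradiction refl d≢0
↥-ratio n (+ suc k)  _   = ↥[i/n]*n≡i*↧[i/n] n (suc k)
↥-ratio n -[1+ k ]   _   = begin
  ↥ r * - (+ suc k)  ≡⟨ ℤP.neg-distribʳ-* (↥ r) (+ suc k) ⟨
  - (↥ r * + suc k)  ≡⟨ cong -_ (↥[i/n]*n≡i*↧[i/n] (- n) (suc k)) ⟩
  - ((- n) * ↧ r)    ≡⟨ cong -_ (ℤP.neg-distribˡ-* n (↧ r)) ⟨
  - - (n * ↧ r)      ≡⟨ ℤP.neg-involutive (n * ↧ r) ⟩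
  n * ↧ r            ∎
  where r = (- n) ℚ./ suc k

↥-ratio-minus : ∀ n d (d≢0 : d ≢ 0ℤ) s → let t = ratio n d d≢0 ℚ.- s in
             ↥ t * (d * ↧ s) ≡ (n * ↧ s - ↥ s * d) * ↧ t
↥-ratio-minus n d d≢0 s = ℤP.*-cancelˡ-≡ (↧ r) _ _
  (replace-r (↥ r) (↧ r) (↥ s) (↧ s) (↥ t) (↧ t) (↥-minus r s) (↥-ratio n d d≢0))
  where
  r = ratio n d d≢0
  t = r ℚ.- s
  replace-r : ∀ x y u v w z → w * (y * v) ≡ (x * v - u * y) * z → x * d ≡ n * y →
              y * (w * (d * v)) ≡ y * ((n * v - u * d) * z)
  replace-r x y u v w z r-s≡w/z x/y≡n/d = begin
    y * (w * (d * v))                ≡⟨ solve (y ∷ w ∷ d ∷ v ∷ []) ⟩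
    d * (w * (y * v))                ≡⟨ cong (d *_) r-s≡w/z ⟩
    d * ((x * v - u * y) * z)        ≡⟨ solve (d ∷ x ∷ v ∷ u ∷ y ∷ z ∷ []) ⟩
    x * d * v * z - y * (u * d * z)  ≡⟨ cong (λ m → m * v * z - y * (u * d * z)) x/y≡n/d ⟩
    n * y * v * z - y * (u * d * z)  ≡⟨ solve (n ∷ y ∷ v ∷ z ∷ u ∷ d ∷ []) ⟩
    y * ((n * v - u * d) * z)        ∎

module _ {P : ℤ} (P-prime : Prime ∣ P ∣) where

  private instance
    P≢0 : ℤ.NonZero P
    P≢0 = prime⇒nonZero P-prime

    P²≢0 : ℤ.NonZero (P * P)
    P²≢0 = ℤP.i*j≢0 P P

    P³≢0 : ℤ.NonZero (P * P * P)
    P³≢0 = ℤP.i*j≢0 (P * P) P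

  ∣m*n⇒∤n⇒∣m : ∀ {m n} → P ∣ m * n → ¬ (P ∣ n) → P ∣ m
  ∣m*n⇒∤n⇒∣m {m} {n} P∣mn P∤n
    with euclidsLemma ∣ m ∣ ∣ n ∣ P-prime (subst (∣ P ∣ ℕD.∣_) (ℤP.abs-* m n) (∣⇒∣ᵤ P∣mn))
  ... | inj₁ P∣m = ∣ᵤ⇒∣ P∣m
  ... | inj₂ P∣n = contradiction (∣ᵤ⇒∣ P∣n) P∤n

  -- A / B ≡ P (mod P²) in ℤ₍ₚ₎: the fraction (A − P B) / B equals N / D with P² ∣ N and P ∤ D.
  record CongruentToP (A B : ℤ) : Set where
    constructor congruentToP
    field
      N D   : ℤ
      P²∣N  : P * P ∣ N
      P∤D   : ¬ (P ∣ D)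
      cross : N * B ≡ (A - P * B) * D

  congruentToP-cancel : ∀ {A B} k .{{_ : ℤ.NonZero k}} → CongruentToP (A * k) (B * k) → CongruentToP A B
  congruentToP-cancel {A} {B} k (congruentToP N D P²∣N P∤D eq) = congruentToP N D P²∣N P∤D
    (ℤP.*-cancelˡ-≡ k _ _ (begin
      k * (N * B)                ≡⟨ solve (k ∷ N ∷ B ∷ []) ⟩
      N * (B * k)                ≡⟨ eq ⟩
      (A * k - P * (B * k)) * D  ≡⟨ solve (P ∷ A ∷ B ∷ k ∷ D ∷ []) ⟩
      k * ((A - P * B) * D)      ∎))

  congruentToP⇒∣num : ∀ {A B} → CongruentToP A B → P ∣ A
  congruentToP⇒∣num {A} {B} (congruentToP N D P²∣N P∤D eq) =
    subst (P ∣_) A-PB+PB≡A (∣m∣n⇒∣m+n P∣A-PB (∣m⇒∣m*n B ∣-refl))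
    where
    A-PB+PB≡A : A - P * B + P * B ≡ A
    A-PB+PB≡A = solve (P ∷ A ∷ B ∷ [])
    P∣A-PB : P ∣ A - P * B
    P∣A-PB = ∣m*n⇒∤n⇒∣m (subst (P ∣_) eq (∣m⇒∣m*n B (∣-trans (∣m⇒∣m*n P ∣-refl) P²∣N))) P∤D

  congruentToP-cube⇒∣den : ∀ {A B} → CongruentToP (A * (P * P * P)) B → P ∣ B
  congruentToP-cube⇒∣den {A} {B} (congruentToP N D (divides n N≡nP²) P∤D eq) =
    subst (P ∣_) AP²-[AP²-B]≡B (∣m∣n⇒∣m-n (∣m⇒∣m*n P (∣n⇒∣m*n A ∣-refl)) P∣AP²-B)
    where
    nPB≡[AP²-B]D : n * P * B ≡ (A * P * P - B) * D
    nPB≡[AP²-B]D = ℤP.*-cancelˡ-≡ P _ _ (begin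
      P * (n * P * B)                ≡⟨ solve (P ∷ n ∷ B ∷ []) ⟩
      n * (P * P) * B                ≡⟨ cong (_* B) N≡nP² ⟨
      N * B                          ≡⟨ eq ⟩
      (A * (P * P * P) - P * B) * D  ≡⟨ solve (P ∷ A ∷ B ∷ D ∷ []) ⟩
      P * ((A * P * P - B) * D)      ∎)
    P∣AP²-B : P ∣ A * P * P - B
    P∣AP²-B = ∣m*n⇒∤n⇒∣m (subst (P ∣_) nPB≡[AP²-B]D (∣m⇒∣m*n B (∣n⇒∣m*n n ∣-refl))) P∤D
    AP²-[AP²-B]≡B : A * P * P - (A * P * P - B) ≡ B
    AP²-[AP²-B]≡B = solve (P ∷ A ∷ B ∷ [])

  ∣i∣<∣i*P³∣ : ∀ i → i ≢ 0ℤ → ∣ i ∣ ℕ.< ∣ i * (P * P * P) ∣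
  ∣i∣<∣i*P³∣ i i≢0 =
    subst (∣ i ∣ ℕ.<_) (sym (ℤP.abs-* i (P * P * P)))
      (ℕP.m<m*n ∣ i ∣ ∣ P * P * P ∣ {{ℤ.≢-nonZero i≢0}} 1<∣P³∣)
    where
    1<∣P³∣ : 1 ℕ.< ∣ P * P * P ∣
    1<∣P³∣ = ℕP.<-≤-trans (ℕ.nonTrivial⇒n>1 ∣ P ∣ {{prime⇒nonTrivial P-prime}})
               (subst (∣ P ∣ ℕ.≤_) (sym (ℤP.abs-* (P * P) P)) (ℕP.m≤n*m ∣ P ∣ ∣ P * P ∣))

  Pℚ : ℚ
  Pℚ = mkℚ P 0 (Coprimality.sym (Coprimality.1-coprimeTo ∣ P ∣))

  ∣↥⇒∤↧ : ∀ r → P ∣ ↥ r → ¬ (P ∣ ↧ r)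
  ∣↥⇒∤↧ (mkℚ _ _ coprime) P∣↥r P∣↧r = ℕ.nonTrivial⇒≢1 {{prime⇒nonTrivial P-prime}}
    (Coprimality.recompute coprime (∣⇒∣ᵤ P∣↥r , ∣⇒∣ᵤ P∣↧r))

  close⇒congruentToP : ∀ A B (B≢0 : B ≢ 0ℤ) → PAdicClose ∣ P ∣ 2 (ratio A B B≢0) Pℚ → CongruentToP A B
  close⇒congruentToP A B B≢0 close =
    congruentToP (↥ t) (↧ t) P²∣↥t (∣↥⇒∤↧ t (∣-trans (∣m⇒∣m*n P ∣-refl) P²∣↥t)) ↥t*B≡[A-PB]*↧t
    where
    t = ratio A B B≢0 ℚ.- Pℚ
    P²∣↥t : P * P ∣ ↥ t
    P²∣↥t = ∣ᵤ⇒∣ (subst (ℕD._∣ ∣ ↥ t ∣)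
              (trans (cong (∣ P ∣ ℕ.*_) (ℕP.*-identityʳ ∣ P ∣)) (sym (ℤP.abs-* P P))) close)
    ↥t*B≡[A-PB]*↧t : ↥ t * B ≡ (A - P * B) * ↧ t
    ↥t*B≡[A-PB]*↧t = subst₂ (λ d n → ↥ t * d ≡ (n - P * B) * ↧ t) (ℤP.*-identityʳ B) (ℤP.*-identityʳ A)
                       (↥-ratio-minus A B B≢0 Pℚ)

  module _ (a b : ℤ) (anisotropic : AnisotropicMod ∣ P ∣ a b) where

    ∣diagCubic⇒∣both : ∀ x y → P ∣ diagCubic a b x y → (P ∣ x) × (P ∣ y)
    ∣diagCubic⇒∣both x y P∣C with P ∣? x | P ∣? y
    ... | yes P∣x | yes P∣y = P∣x , P∣y
    ... | no P∤x  | _       = contradiction (∣⇒∣ᵤ P∣C) (anisotropic x y (λ (P∣x , _) → P∤x (∣ᵤ⇒∣ P∣x)))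
    ... | _       | no P∤y  = contradiction (∣⇒∣ᵤ P∣C) (anisotropic x y (λ (_ , P∣y) → P∤y (∣ᵤ⇒∣ P∣y)))

    record Represented (A : ℤ) : Set where
      constructor represented
      field
        x y : ℤ
        C[x,y]≡A : diagCubic a b x y ≡ A

    represented-descent : ∀ {A} → Represented A → P ∣ A →
                          Σ ℤ λ A′ → Represented A′ × A ≡ A′ * (P * P * P)
    represented-descent (represented x y refl) P∣A with ∣diagCubic⇒∣both x y P∣A
    ... | divides u x≡uP , divides v y≡vP =
      diagCubic a b u v , represented u v refl ,
      subst₂ (λ x y → diagCubic a b x y ≡ diagCubic a b u v * (P * P * P)) (sym x≡uP) (sym y≡vP)
        (diagCubic-scale a b u v P)

    ¬congruentToP-acc : ∀ {A B} → Represented A → Represented B → Acc ℕ._<_ ∣ B ∣ → B ≢ 0ℤ →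
                        ¬ CongruentToP A B
    ¬congruentToP-acc {A} {B} repA repB (acc smaller) B≢0 A/B≡P =
      let A′ , repA′ , A≡A′P³ = represented-descent repA (congruentToP⇒∣num A/B≡P)
          A′P³/B≡P = subst (λ A → CongruentToP A B) A≡A′P³ A/B≡P
          B′ , repB′ , B≡B′P³ = represented-descent repB (congruentToP-cube⇒∣den {A′} A′P³/B≡P)
          B′≢0 : B′ ≢ 0ℤ
          B′≢0 B′≡0 = B≢0 (trans B≡B′P³ (cong (_* (P * P * P)) B′≡0))
          ∣B′∣<∣B∣ = subst (λ j → ∣ B′ ∣ ℕ.< ∣ j ∣) (sym B≡B′P³) (∣i∣<∣i*P³∣ B′ B′≢0)
      in ¬congruentToP-acc repA′ repB′ (smaller ∣B′∣<∣B∣) B′≢0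
           (congruentToP-cancel {A′} {B′} (P * P * P) (subst (CongruentToP _) B≡B′P³ A′P³/B≡P))

    ¬congruentToP : ∀ x x' y y' → diagCubic a b y y' ≢ 0ℤ →
                    ¬ CongruentToP (diagCubic a b x x') (diagCubic a b y y')
    ¬congruentToP x x' y y' =
      ¬congruentToP-acc (represented x x' refl) (represented y y' refl) (<-wellFounded _)

theorem1p1 : (p : ℕ) → Prime p → (a b : ℤ) → a ≢ 0ℤ → b ≢ 0ℤ → gcd a b ≡ 1ℤ →
    AnisotropicMod p a b → ¬ DenseInQp p (InRatioSet a b)
theorem1p1 p p-prime a b _ _ _ anisotropic dense =
  let r , (x , x' , y , y' , Cy≢0 , r≡Cx/Cy) , close = dense (Pℚ {P = + p} p-prime) 2 in
  ¬congruentToP p-prime a b anisotropic x x' y y' Cy≢0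
    (close⇒congruentToP p-prime (diagCubic a b x x') (diagCubic a b y y') Cy≢0
      (subst (λ r → PAdicClose p 2 r (Pℚ p-prime)) r≡Cx/Cy close))
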